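{- Let $R$ be a finite commutative ring, $V$ a finite $R$-module and $e\in E(R)$. Then there is a surjective monoid homomorphism $\Phi_e\colon\mathrm{Aff}(V)\to\mathrm{Aff}(eV)$ given by $\Phi_e(ax+b)=aex+eb$. Moreover, the restriction $\Phi_e\colon U(\mathrm{Aff}(V))\to U(\mathrm{Aff}(eV))$ is surjective.
   Context: For a module $M$ over a commutative ring $S$, $\mathrm{Aff}(M)$ is the monoid of all maps $M\to M$ of the form $x\mapsto ax+b$ ($a\in S$, $b\in M$) under composition; $eV$ is regarded as a module over the unital ring $Re$ (identity $e$), so $\mathrm{Aff}(eV)$ consists of maps $ax+b$ with $a\in Re$, $b\in eV$ and has identity $ex$. $E(R)$ is the set of idempotents of $R$, and $U(\cdot)$ denotes group of units. -}

module Defs where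

open import Level using (Level; _⊔_)
open import Data.Nat using (ℕ)
open import Data.Fin using (Fin)
open import Data.Product using (Σ; ∃; _×_; _,_)
open import Relation.Binary using (Rel)
open import Algebra.Bundles using (CommutativeRing)
open import Algebra.Module.Bundles using (Module)

Finite : ∀ {a ℓ} (A : Set a) → Rel A ℓ → Set (a ⊔ ℓ)
Finite A _≈_ = Σ ℕ λ n → Σ (Fin n → A) λ enum → ∀ x → ∃ λ i → enum i ≈ x

module AffineMaps {r ℓr m ℓm} (R : CommutativeRing r ℓr) (V : Module R m ℓm) where
  open CommutativeRing R
  open Module V

  IsIdempotent : Carrier → Set ℓr
  IsIdempotent e = e * e ≈ e

  -- An element of Aff(M) (M = V or eV) is written x ↦ a x + b,
  -- represented by the pair (a , b).
  record Affine : Set (r ⊔ m) where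
    constructor aff
    field
      coeff : Carrier
      trans : Carrierᴹ
  open Affine public

  ⟦_⟧ : Affine → Carrierᴹ → Carrierᴹ
  ⟦ f ⟧ x = coeff f *ₗ x +ᴹ trans f

  module _ (e : Carrier) where
    InEV : Carrierᴹ → Set (m ⊔ ℓm)
    InEV v = ∃ λ w → v ≈ᴹ e *ₗ w

    InRe : Carrier → Set (r ⊔ ℓr)
    InRe a = ∃ λ s → a ≈ s * e

    IsAffEV : Affine → Set (r ⊔ ℓr ⊔ m ⊔ ℓm)
    IsAffEV f = InRe (coeff f) × InEV (trans f)

    _≋V_ : Affine → Affine → Set (m ⊔ ℓm)
    f ≋V g = ∀ x → ⟦ f ⟧ x ≈ᴹ ⟦ g ⟧ x

    _≋eV_ : Affine → Affine → Set (m ⊔ ℓm)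
    f ≋eV g = ∀ x → InEV x → ⟦ f ⟧ x ≈ᴹ ⟦ g ⟧ x

    idV : Affine
    idV = aff 1# 0ᴹ

    idEV : Affine
    idEV = aff e 0ᴹ

    IsCompV : Affine → Affine → Affine → Set (m ⊔ ℓm)
    IsCompV h f g = ∀ x → ⟦ h ⟧ x ≈ᴹ ⟦ f ⟧ (⟦ g ⟧ x)

    IsCompEV : Affine → Affine → Affine → Set (m ⊔ ℓm)
    IsCompEV h f g = ∀ x → InEV x → ⟦ h ⟧ x ≈ᴹ ⟦ f ⟧ (⟦ g ⟧ x)

    IsUnitV : Affine → Set (r ⊔ m ⊔ ℓm)
    IsUnitV f = ∃ λ g → IsCompV idV f g × IsCompV idV g f

    IsUnitEV : Affine → Set (r ⊔ ℓr ⊔ m ⊔ ℓm)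
    IsUnitEV f = ∃ λ g → IsAffEV g × IsCompEV idEV f g × IsCompEV idEV g f

    Φ : Affine → Affine
    Φ f = aff (coeff f * e) (e *ₗ trans f)

module Submission where

-- Let e be an idempotent of the commutative ring R and u = 1 - e its
-- complementary idempotent, so that e u = 0, u u = u and e + u = 1.
--
-- * Evaluating Φ_e(f) at x gives e · f(x), and e · f(e y) = e · f(y).
--   These two facts make Φ_e well defined, multiplicative and unital;
--   they are proved in the module Projection below.
-- * Every x ↦ a x + b with a ∈ Re, b ∈ eV is already fixed by Φ_e,
--   which gives surjectivity on all of Aff(eV).
-- * For units we lift a unit x ↦ a x + b of Aff(eV), with inverse
--   x ↦ a' x + b', to x ↦ (a + u) x + b on V.  Composing the two maps on
--   eV shows that a a' acts as the identity on eV; since a, a' ∈ Re this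
--   gives that (a + u)(a' + u) = a a' + u acts as the identity on V, and an
--   affine map whose coefficient is invertible in this sense is a unit of
--   Aff(V) (module AffineAlgebra).  Finally (a + u) e = a, so the lift is
--   mapped to the given unit.

open import Defs
open import Data.Product using (∃; _×_; _,_)
open import Algebra.Bundles using (CommutativeRing)
open import Algebra.Module.Bundles using (Module)
open import Data.Maybe using (nothing)
open import Tactic.RingSolver using (solve-∀)
open import Tactic.RingSolver.Core.AlmostCommutativeRing using (AlmostCommutativeRing; fromCommutativeRing)
import Algebra.Properties.Group as GroupProperties
import Algebra.Properties.Ring as RingProperties
import Relation.Binary.Reasoning.Setoid as SetoidReasoning

-- Expanding a product of two binomials with a common summand, stated over
-- the ring solver's view of R (which is definitionally R).
module RingIdentities {r ℓ} (R : CommutativeRing r ℓ) where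
  acr : AlmostCommutativeRing r ℓ
  acr = fromCommutativeRing R (λ _ → nothing)
  open AlmostCommutativeRing acr

  *-expand : ∀ a a' w → (a + w) * (a' + w) ≈ a * a' + a * w + a' * w + w * w
  *-expand = solve-∀ acr

module IdempotentComplement {r ℓ} (R : CommutativeRing r ℓ)
         (e : CommutativeRing.Carrier R)
         (idem : CommutativeRing._≈_ R (CommutativeRing._*_ R e e) e) where
  open CommutativeRing R
  open RingIdentities R
  open GroupProperties +-group using (x≈y⇒x∙y⁻¹≈ε; ε⁻¹≈ε)
  open RingProperties ring using (-‿distribʳ-*)
  open SetoidReasoning setoid

  *-complement : ∀ a x → a * (1# + - x) ≈ a + - (a * x)
  *-complement a x = begin
    a * (1# + - x)     ≈⟨ distribˡ a 1# (- x) ⟩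
    a * 1# + a * - x   ≈⟨ +-cong (*-identityʳ a) (sym (-‿distribʳ-* a x)) ⟩
    a + - (a * x)      ∎

  u : Carrier
  u = 1# + - e

  Re-absorbs : ∀ {a} s → a ≈ s * e → a * e ≈ a
  Re-absorbs {a} s a≈se = begin
    a * e        ≈⟨ *-congʳ a≈se ⟩
    s * e * e    ≈⟨ *-assoc s e e ⟩
    s * (e * e)  ≈⟨ *-congˡ idem ⟩
    s * e        ≈⟨ a≈se ⟨
    a            ∎

  Re-kills-u : ∀ {a} → a * e ≈ a → a * u ≈ 0#
  Re-kills-u {a} ae≈a = trans (*-complement a e) (x≈y⇒x∙y⁻¹≈ε (sym ae≈a))

  u-kills-Re : ∀ {a} → a * e ≈ a → u * a ≈ 0#
  u-kills-Re ae≈a = trans (*-comm u _) (Re-kills-u ae≈a)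

  u-idempotent : u * u ≈ u
  u-idempotent = begin
    u * u          ≈⟨ *-complement u e ⟩
    u + - (u * e)  ≈⟨ +-congˡ (-‿cong (u-kills-Re idem)) ⟩
    u + - 0#       ≈⟨ +-congˡ ε⁻¹≈ε ⟩
    u + 0#         ≈⟨ +-identityʳ u ⟩
    u              ∎

  shifted-product : ∀ {a a'} → a * e ≈ a → a' * e ≈ a' →
                    (a + u) * (a' + u) ≈ a * a' + u
  shifted-product {a} {a'} ae≈a a'e≈a' = begin
    (a + u) * (a' + u)                 ≈⟨ *-expand a a' u ⟩
    a * a' + a * u + a' * u + u * u    ≈⟨ +-cong (+-cong (+-congˡ (Re-kills-u ae≈a))
                                                        (Re-kills-u a'e≈a'))
                                                 u-idempotent ⟩
    a * a' + 0# + 0# + u               ≈⟨ +-congʳ (trans (+-identityʳ _) (+-identityʳ _)) ⟩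
    a * a' + u                         ∎

  shift-projects : ∀ {a} → a * e ≈ a → (a + u) * e ≈ a
  shift-projects {a} ae≈a = begin
    (a + u) * e    ≈⟨ distribʳ e a u ⟩
    a * e + u * e  ≈⟨ +-cong ae≈a (u-kills-Re idem) ⟩
    a + 0#         ≈⟨ +-identityʳ a ⟩
    a              ∎

  complement-sum : e + u ≈ 1#
  complement-sum = begin
    e + (1# + - e)  ≈⟨ +-congˡ (+-comm 1# (- e)) ⟩
    e + (- e + 1#)  ≈⟨ +-assoc e (- e) 1# ⟨
    e + - e + 1#    ≈⟨ +-congʳ (-‿inverseʳ e) ⟩
    0# + 1#         ≈⟨ +-identityˡ 1# ⟩
    1#              ∎

module AffineAlgebra {r ℓr m ℓm} (R : CommutativeRing r ℓr) (V : Module R m ℓm) where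
  open CommutativeRing R
  open Module V
  open AffineMaps R V hiding (trans)
  open SetoidReasoning ≈ᴹ-setoid

  ⟦⟧-cong : ∀ f {x y} → x ≈ᴹ y → ⟦ f ⟧ x ≈ᴹ ⟦ f ⟧ y
  ⟦⟧-cong f x≈y = +ᴹ-congʳ (*ₗ-congˡ x≈y)

  ⟦id⟧ : ∀ x → 1# *ₗ x +ᴹ 0ᴹ ≈ᴹ x
  ⟦id⟧ x = ≈ᴹ-trans (+ᴹ-identityʳ _) (*ₗ-identityˡ x)

  ⟦⟧-compose : ∀ c b c' b' x →
               ⟦ aff c b ⟧ (⟦ aff c' b' ⟧ x) ≈ᴹ (c * c') *ₗ x +ᴹ (c *ₗ b' +ᴹ b)
  ⟦⟧-compose c b c' b' x = begin
    c *ₗ (c' *ₗ x +ᴹ b') +ᴹ b          ≈⟨ +ᴹ-congʳ (*ₗ-distribˡ c _ _) ⟩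
    c *ₗ (c' *ₗ x) +ᴹ c *ₗ b' +ᴹ b     ≈⟨ +ᴹ-assoc _ _ _ ⟩
    c *ₗ (c' *ₗ x) +ᴹ (c *ₗ b' +ᴹ b)   ≈⟨ +ᴹ-congʳ (*ₗ-assoc c c' x) ⟨
    (c * c') *ₗ x +ᴹ (c *ₗ b' +ᴹ b)    ∎

  undo-after : ∀ c c' b → (∀ v → (c' * c) *ₗ v ≈ᴹ v) →
               ∀ x → ⟦ aff c' (c' *ₗ (-ᴹ b)) ⟧ (⟦ aff c b ⟧ x) ≈ᴹ x
  undo-after c c' b c'c≈1 x = begin
    ⟦ aff c' (c' *ₗ (-ᴹ b)) ⟧ (⟦ aff c b ⟧ x)        ≈⟨ ⟦⟧-compose c' _ c b x ⟩
    (c' * c) *ₗ x +ᴹ (c' *ₗ b +ᴹ c' *ₗ (-ᴹ b))     ≈⟨ +ᴹ-cong (c'c≈1 x) (≈ᴹ-sym (*ₗ-distribˡ c' b (-ᴹ b))) ⟩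
    x +ᴹ c' *ₗ (b +ᴹ -ᴹ b)                          ≈⟨ +ᴹ-congˡ (*ₗ-congˡ (-ᴹ‿inverseʳ b)) ⟩
    x +ᴹ c' *ₗ 0ᴹ                                   ≈⟨ +ᴹ-congˡ (*ₗ-zeroʳ c') ⟩
    x +ᴹ 0ᴹ                                         ≈⟨ +ᴹ-identityʳ x ⟩
    x                                               ∎

  undo-before : ∀ c c' b → (∀ v → (c * c') *ₗ v ≈ᴹ v) →
                ∀ x → ⟦ aff c b ⟧ (⟦ aff c' (c' *ₗ (-ᴹ b)) ⟧ x) ≈ᴹ x
  undo-before c c' b cc'≈1 x = begin
    ⟦ aff c b ⟧ (⟦ aff c' (c' *ₗ (-ᴹ b)) ⟧ x)       ≈⟨ ⟦⟧-compose c b c' _ x ⟩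
    (c * c') *ₗ x +ᴹ (c *ₗ (c' *ₗ (-ᴹ b)) +ᴹ b)   ≈⟨ +ᴹ-cong (cc'≈1 x) (+ᴹ-congʳ (≈ᴹ-sym (*ₗ-assoc c c' (-ᴹ b)))) ⟩
    x +ᴹ ((c * c') *ₗ (-ᴹ b) +ᴹ b)                 ≈⟨ +ᴹ-congˡ (+ᴹ-congʳ (cc'≈1 (-ᴹ b))) ⟩
    x +ᴹ (-ᴹ b +ᴹ b)                               ≈⟨ +ᴹ-congˡ (-ᴹ‿inverseˡ b) ⟩
    x +ᴹ 0ᴹ                                        ≈⟨ +ᴹ-identityʳ x ⟩
    x                                              ∎

  invertible-coeff⇒unit : ∀ e c c' b → (∀ v → (c * c') *ₗ v ≈ᴹ v) → IsUnitV e (aff c b)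
  invertible-coeff⇒unit e c c' b cc'≈1 =
    aff c' (c' *ₗ (-ᴹ b)) ,
    (λ x → ≈ᴹ-trans (⟦id⟧ x) (≈ᴹ-sym (undo-before c c' b cc'≈1 x))) ,
    (λ x → ≈ᴹ-trans (⟦id⟧ x) (≈ᴹ-sym (undo-after c c' b c'c≈1 x)))
    where
    c'c≈1 : ∀ v → (c' * c) *ₗ v ≈ᴹ v
    c'c≈1 v = ≈ᴹ-trans (*ₗ-congʳ (*-comm c' c)) (cc'≈1 v)

module Projection {r ℓr m ℓm} (R : CommutativeRing r ℓr) (V : Module R m ℓm)
         (e : CommutativeRing.Carrier R)
         (idem : CommutativeRing._≈_ R (CommutativeRing._*_ R e e) e) where
  open CommutativeRing R
  open Module V
  open AffineMaps R V hiding (trans)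
  open AffineAlgebra R V
  open IdempotentComplement R e idem
  open SetoidReasoning ≈ᴹ-setoid

  e-idempotent-action : ∀ y → e *ₗ (e *ₗ y) ≈ᴹ e *ₗ y
  e-idempotent-action y = ≈ᴹ-trans (≈ᴹ-sym (*ₗ-assoc e e y)) (*ₗ-congʳ idem)

  eV-fixed : ∀ {b} → InEV e b → e *ₗ b ≈ᴹ b
  eV-fixed {b} (w , b≈ew) = begin
    e *ₗ b          ≈⟨ *ₗ-congˡ b≈ew ⟩
    e *ₗ (e *ₗ w)   ≈⟨ e-idempotent-action w ⟩
    e *ₗ w          ≈⟨ b≈ew ⟨
    b               ∎

  Φ-eval : ∀ f x → ⟦ Φ e f ⟧ x ≈ᴹ e *ₗ ⟦ f ⟧ x
  Φ-eval (aff a b) x = begin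
    (a * e) *ₗ x +ᴹ e *ₗ b    ≈⟨ +ᴹ-congʳ (*ₗ-congʳ (*-comm a e)) ⟩
    (e * a) *ₗ x +ᴹ e *ₗ b    ≈⟨ +ᴹ-congʳ (*ₗ-assoc e a x) ⟩
    e *ₗ (a *ₗ x) +ᴹ e *ₗ b   ≈⟨ *ₗ-distribˡ e (a *ₗ x) b ⟨
    e *ₗ (a *ₗ x +ᴹ b)        ∎

  Φ-eval-projected : ∀ f y → e *ₗ ⟦ f ⟧ (e *ₗ y) ≈ᴹ e *ₗ ⟦ f ⟧ y
  Φ-eval-projected (aff a b) y = begin
    e *ₗ ⟦ aff a b ⟧ (e *ₗ y)         ≈⟨ Φ-eval (aff a b) (e *ₗ y) ⟨
    (a * e) *ₗ (e *ₗ y) +ᴹ e *ₗ b     ≈⟨ +ᴹ-congʳ (*ₗ-assoc (a * e) e y) ⟨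
    (a * e * e) *ₗ y +ᴹ e *ₗ b        ≈⟨ +ᴹ-congʳ (*ₗ-congʳ (Re-absorbs a refl)) ⟩
    (a * e) *ₗ y +ᴹ e *ₗ b            ≈⟨ Φ-eval (aff a b) y ⟩
    e *ₗ ⟦ aff a b ⟧ y                ∎

  Φ-coeff : ∀ {c a b} → c * e ≈ a → InEV e b → _≋eV_ e (Φ e (aff c b)) (aff a b)
  Φ-coeff ce≈a b∈eV x _ = +ᴹ-cong (*ₗ-congʳ ce≈a) (eV-fixed b∈eV)

  identity-on-eV : ∀ c k → _≋eV_ e (idEV e) (aff c k) → ∀ v → c *ₗ (e *ₗ v) ≈ᴹ e *ₗ v
  identity-on-eV c k id≋ v = begin
    c *ₗ (e *ₗ v)             ≈⟨ +ᴹ-identityʳ _ ⟨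
    c *ₗ (e *ₗ v) +ᴹ 0ᴹ       ≈⟨ +ᴹ-congˡ k≈0 ⟨
    c *ₗ (e *ₗ v) +ᴹ k        ≈⟨ id≋ (e *ₗ v) (v , ≈ᴹ-refl) ⟨
    e *ₗ (e *ₗ v) +ᴹ 0ᴹ       ≈⟨ +ᴹ-identityʳ _ ⟩
    e *ₗ (e *ₗ v)             ≈⟨ e-idempotent-action v ⟩
    e *ₗ v                    ∎
    where
    k≈0 : k ≈ᴹ 0ᴹ
    k≈0 = begin
      k                 ≈⟨ +ᴹ-identityˡ k ⟨
      0ᴹ +ᴹ k           ≈⟨ +ᴹ-congʳ (*ₗ-zeroʳ c) ⟨
      c *ₗ 0ᴹ +ᴹ k      ≈⟨ id≋ 0ᴹ (0ᴹ , ≈ᴹ-sym (*ₗ-zeroʳ e)) ⟨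
      e *ₗ 0ᴹ +ᴹ 0ᴹ     ≈⟨ +ᴹ-identityʳ _ ⟩
      e *ₗ 0ᴹ           ≈⟨ *ₗ-zeroʳ e ⟩
      0ᴹ                ∎

  lifted-coeff-invertible : ∀ {a a'} → a * e ≈ a → a' * e ≈ a' →
    (∀ v → (a * a') *ₗ (e *ₗ v) ≈ᴹ e *ₗ v) →
    ∀ v → ((a + u) * (a' + u)) *ₗ v ≈ᴹ v
  lifted-coeff-invertible {a} {a'} ae≈a a'e≈a' aa'≈1 v = begin
    ((a + u) * (a' + u)) *ₗ v        ≈⟨ *ₗ-congʳ (shifted-product ae≈a a'e≈a') ⟩
    (a * a' + u) *ₗ v                ≈⟨ *ₗ-distribʳ v (a * a') u ⟩
    (a * a') *ₗ v +ᴹ u *ₗ v          ≈⟨ +ᴹ-congʳ (*ₗ-congʳ (*-congˡ a'e≈a')) ⟨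
    (a * (a' * e)) *ₗ v +ᴹ u *ₗ v    ≈⟨ +ᴹ-congʳ (*ₗ-congʳ (*-assoc a a' e)) ⟨
    (a * a' * e) *ₗ v +ᴹ u *ₗ v      ≈⟨ +ᴹ-congʳ (*ₗ-assoc (a * a') e v) ⟩
    (a * a') *ₗ (e *ₗ v) +ᴹ u *ₗ v   ≈⟨ +ᴹ-congʳ (aa'≈1 v) ⟩
    e *ₗ v +ᴹ u *ₗ v                 ≈⟨ *ₗ-distribʳ v e u ⟨
    (e + u) *ₗ v                     ≈⟨ *ₗ-congʳ complement-sum ⟩
    1# *ₗ v                          ≈⟨ *ₗ-identityˡ v ⟩
    v                                ∎

  Φ-lands-in-AffEV : ∀ f → IsAffEV e (Φ e f)
  Φ-lands-in-AffEV (aff a b) = (a , refl) , (b , ≈ᴹ-refl)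

  Φ-well-defined : ∀ f g → _≋V_ e f g → _≋eV_ e (Φ e f) (Φ e g)
  Φ-well-defined f g f≋g x _ = begin
    ⟦ Φ e f ⟧ x     ≈⟨ Φ-eval f x ⟩
    e *ₗ ⟦ f ⟧ x    ≈⟨ *ₗ-congˡ (f≋g x) ⟩
    e *ₗ ⟦ g ⟧ x    ≈⟨ Φ-eval g x ⟨
    ⟦ Φ e g ⟧ x     ∎

  Φ-compose : ∀ f g h → IsCompV e h f g → IsCompEV e (Φ e h) (Φ e f) (Φ e g)
  Φ-compose f g h h≋fg x _ = begin
    ⟦ Φ e h ⟧ x                    ≈⟨ Φ-eval h x ⟩
    e *ₗ ⟦ h ⟧ x                   ≈⟨ *ₗ-congˡ (h≋fg x) ⟩
    e *ₗ ⟦ f ⟧ (⟦ g ⟧ x)           ≈⟨ Φ-eval-projected f (⟦ g ⟧ x) ⟨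
    e *ₗ ⟦ f ⟧ (e *ₗ ⟦ g ⟧ x)      ≈⟨ *ₗ-congˡ (⟦⟧-cong f (Φ-eval g x)) ⟨
    e *ₗ ⟦ f ⟧ (⟦ Φ e g ⟧ x)       ≈⟨ Φ-eval f _ ⟨
    ⟦ Φ e f ⟧ (⟦ Φ e g ⟧ x)        ∎

  Φ-identity : _≋eV_ e (Φ e (idV e)) (idEV e)
  Φ-identity = Φ-coeff (*-identityˡ e) (0ᴹ , ≈ᴹ-sym (*ₗ-zeroʳ e))

  Φ-surjective : ∀ g → IsAffEV e g → ∃ λ f → _≋eV_ e (Φ e f) g
  Φ-surjective (aff a b) ((s , a≈se) , b∈eV) = aff a b , Φ-coeff (Re-absorbs s a≈se) b∈eV

  Φ-surjective-on-units : ∀ g → IsAffEV e g → IsUnitEV e g →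
                          ∃ λ f → IsUnitV e f × _≋eV_ e (Φ e f) g
  Φ-surjective-on-units (aff a b) ((s , a≈se) , b∈eV)
                        (aff a' b' , ((s' , a'≈s'e) , _) , id≋gg' , _) =
    aff (a + u) b ,
    invertible-coeff⇒unit e (a + u) (a' + u) b
      (lifted-coeff-invertible ae≈a a'e≈a' (identity-on-eV (a * a') _ id≋composite)) ,
    Φ-coeff (shift-projects ae≈a) b∈eV
    where
    ae≈a : a * e ≈ a
    ae≈a = Re-absorbs s a≈se
    a'e≈a' : a' * e ≈ a'
    a'e≈a' = Re-absorbs s' a'≈s'e
    id≋composite : _≋eV_ e (idEV e) (aff (a * a') (a *ₗ b' +ᴹ b))
    id≋composite x x∈eV = ≈ᴹ-trans (id≋gg' x x∈eV) (⟦⟧-compose a b a' b' x)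

proposition3p5 : ∀ {r ℓr m ℓm} (R : CommutativeRing r ℓr) (V : Module R m ℓm) →
    Finite (CommutativeRing.Carrier R) (CommutativeRing._≈_ R) →
    Finite (Module.Carrierᴹ V) (Module._≈ᴹ_ V) →
    let open AffineMaps R V in
    (e : CommutativeRing.Carrier R) → IsIdempotent e →
    ((f : Affine) → IsAffEV e (Φ e f))
    × ((f g : Affine) → _≋V_ e f g → _≋eV_ e (Φ e f) (Φ e g))
    × ((f g h : Affine) → IsCompV e h f g → IsCompEV e (Φ e h) (Φ e f) (Φ e g))
    × _≋eV_ e (Φ e (idV e)) (idEV e)
    × ((g : Affine) → IsAffEV e g → ∃ λ f → _≋eV_ e (Φ e f) g)
    × ((g : Affine) → IsAffEV e g → IsUnitEV e g →
    ∃ λ f → IsUnitV e f × _≋eV_ e (Φ e f) g)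
proposition3p5 R V _ _ e idem =
  Φ-lands-in-AffEV , Φ-well-defined , Φ-compose , Φ-identity ,
  Φ-surjective , Φ-surjective-on-units
  where open Projection R V e idem
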